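{- Let $t\ge 2$, let $n\ge t+1$, and put $N=n-t$. Then \[ M_{ -t}(n)= \min_{\varepsilon\in\{0,1\}} \ \min_{0\le a\le t-1} \ \min_{0\le q\le \lfloor N/2\rfloor} G_{t,N,a,\varepsilon}(q), \] where \begin{align*} G_{t,N,a,\varepsilon}(q) ={}& S(1,q)+S(q+1,N) +\binom{a+\varepsilon+1}{2}\,q +\binom{t-a-\varepsilon+1}{2}\,(N-q) \\ &+a\binom{q+1}{2} +(t-1-a)\binom{N-q+1}{2} +\varepsilon\binom{q}{2} +(1-\varepsilon)\binom{N-q}{2} \\ &+\binom{a+\varepsilon+2}{3} +\binom{t-a-\varepsilon+2}{3}-1. \end{align*} Moreover, for every fixed triple $(a,\varepsilon,q)$ with $0\le q\le N/2$, equality $s(\Delta;1-t,n-t)=G_{t,N,a,\varepsilon}(q)$ is attained by a coloring $\Delta$ of $[1-t,n-t]$ in which exactly $a$ of the negative integers in $[1-t,-1]$ have color $0$, the integer $0$ has color $0$ if $\varepsilon=1$ and color $1$ if $\varepsilon=0$, and whose positive part is the two-block coloring with $[1,q]$ in color $0$ and $[q+1,N]$ in color $1$.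
   Context: Consider the strict Schur inequality system $\mathcal E$: $x_1\le x_2\le x_3$ and $x_1+x_2<x_3$ over the integers. For integers $a\le b$ write $[a,b]=\{m\in\mathbb Z: a\le m\le b\}$. For a $2$-coloring $\Delta:[a,b]\to\{0,1\}$, let $s(\Delta;a,b)$ be the number of monochromatic triples $(x_1,x_2,x_3)$ with $x_1,x_2,x_3\in[a,b]$ satisfying $\mathcal E$. For integers $k$ and $n\ge1$, $M_k(n)$ is the minimum of $s(\Delta;k+1,k+n)$ over all $2$-colorings $\Delta$ of $[k+1,k+n]$; here $k=-t$, so the interval is $[1-t,n-t]$. For integers $1\le a\le b$, $S(a,b)$ denotes the total number of triples $(x_1,x_2,x_3)$ with $x_1,x_2,x_3\in[a,b]$ satisfying $\mathcal E$ (no coloring involved), and $S(a,b)=0$ if $a>b$; explicitly $S(a,b)=0$ if $b-2a\le 0$, $S(a,b)=u(u+1)(4u+5)/6$ if $b-2a=2u\ge 2$, and $S(a,b)=(u+1)(u+2)(4u+3)/6$ if $b-2a=2u+1\ge 1$. In the formula, $a$ plays the role of the number of negative integers of color $0$ in $[1-t,-1]$, $\varepsilon$ records the color of $0$ ($\varepsilon=1$ iff $0$ has color $0$), and $q$ is the number of positive integers of color $0$ in $[1,N]$. -}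

module Defs where

open import Data.Nat as ℕ using (ℕ; zero; suc; _⊓_; _/_)
open import Data.Nat.Combinatorics using (_C_)
open import Data.Integer as ℤ using (ℤ; +_; -[1+_]; 1ℤ; 0ℤ)
open import Data.Integer.Properties as ℤP using ()
open import Data.Fin as Fin using (Fin)
open import Data.List using (List; []; _∷_; length; filter; map; concatMap; foldr; upTo; _++_)
open import Data.Product using (_×_; _,_)
open import Relation.Nullary using (Dec)
open import Relation.Nullary.Decidable using (_×-dec_)
open import Relation.Binary.PropositionalEquality using (_≡_)

Coloring : Set
Coloring = ℤ → Fin 2

lenℤ : ℤ → ℕ
lenℤ (+ m) = m
lenℤ -[1+ _ ] = 0

range : ℤ → ℕ → List ℤ
range a zero = []
range a (suc m) = a ∷ range (a ℤ.+ 1ℤ) m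

interval : ℤ → ℤ → List ℤ
interval a b = range a (lenℤ (b ℤ.- a ℤ.+ 1ℤ))

triples : List ℤ → List (ℤ × ℤ × ℤ)
triples xs = concatMap (λ x → concatMap (λ y → map (λ z → (x , y , z)) xs) xs) xs

SchurE : ℤ × ℤ × ℤ → Set
SchurE (x , y , z) = (x ℤ.≤ y) × (y ℤ.≤ z) × (x ℤ.+ y ℤ.< z)

SchurE? : (p : ℤ × ℤ × ℤ) → Dec (SchurE p)
SchurE? (x , y , z) = (x ℤ.≤? y) ×-dec ((y ℤ.≤? z) ×-dec (x ℤ.+ y ℤ.<? z))

MonoE : Coloring → ℤ × ℤ × ℤ → Set
MonoE Δ (x , y , z) = SchurE (x , y , z) × (Δ x ≡ Δ y) × (Δ y ≡ Δ z)

MonoE? : (Δ : Coloring) → (p : ℤ × ℤ × ℤ) → Dec (MonoE Δ p)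
MonoE? Δ (x , y , z) = SchurE? (x , y , z) ×-dec ((Δ x Fin.≟ Δ y) ×-dec (Δ y Fin.≟ Δ z))

s : Coloring → ℤ → ℤ → ℕ
s Δ a b = length (filter (MonoE? Δ) (triples (interval a b)))

S : ℕ → ℕ → ℕ
S a b = length (filter SchurE? (triples (interval (+ a) (+ b))))

allColorLists : ℕ → List (List (Fin 2))
allColorLists zero = [] ∷ []
allColorLists (suc n) = concatMap (λ cs → (Fin.zero ∷ cs) ∷ (Fin.suc Fin.zero ∷ cs) ∷ []) (allColorLists n)

nth : List (Fin 2) → ℕ → Fin 2
nth [] _ = Fin.zero
nth (c ∷ cs) zero = c
nth (c ∷ cs) (suc i) = nth cs i

-- the coloring of [start, start+length cs-1] given by the list cs
-- (values outside that interval are irrelevant for s on that interval)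
listColoring : ℤ → List (Fin 2) → Coloring
listColoring start cs x = nth cs (lenℤ (x ℤ.- start))

-- minimum of a (nonempty) list of naturals; 0 for the empty list
minOf : List ℕ → ℕ
minOf [] = 0
minOf (x ∷ xs) = foldr _⊓_ x xs

M : ℤ → ℕ → ℕ
M k n = minOf (map (λ cs → s (listColoring (k ℤ.+ 1ℤ) cs) (k ℤ.+ 1ℤ) (k ℤ.+ + n))
                   (allColorLists n))

-- G_{t,N,a,ε}(q); all truncated subtractions are exact in the range
-- a ≤ t-1, ε ≤ 1, q ≤ N, and the total sum is ≥ 1 there
G : ℕ → ℕ → ℕ → ℕ → ℕ → ℕ
G t N a ε q =
  (S 1 q ℕ.+ S (suc q) N
   ℕ.+ ((a ℕ.+ ε ℕ.+ 1) C 2) ℕ.* q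
   ℕ.+ ((t ℕ.∸ a ℕ.∸ ε ℕ.+ 1) C 2) ℕ.* (N ℕ.∸ q)
   ℕ.+ a ℕ.* ((q ℕ.+ 1) C 2)
   ℕ.+ (t ℕ.∸ 1 ℕ.∸ a) ℕ.* ((N ℕ.∸ q ℕ.+ 1) C 2)
   ℕ.+ ε ℕ.* (q C 2)
   ℕ.+ (1 ℕ.∸ ε) ℕ.* ((N ℕ.∸ q) C 2)
   ℕ.+ ((a ℕ.+ ε ℕ.+ 2) C 3)
   ℕ.+ ((t ℕ.∸ a ℕ.∸ ε ℕ.+ 2) C 3)) ℕ.∸ 1

Gmin : ℕ → ℕ → ℕ
Gmin t N = minOf (concatMap (λ ε → concatMap (λ a → map (λ q → G t N a ε q)
                   (upTo (suc (N / 2)))) (upTo t)) (0 ∷ 1 ∷ []))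

countColor0 : Coloring → ℤ → ℤ → ℕ
countColor0 Δ a b = length (filter (λ x → Δ x Fin.≟ Fin.zero) (interval a b))

{-# OPTIONS --safe #-}
-- Write t = d + 1 and index the integers 1 − t, …, N by 0, …, d + N.  When x₁ < 0 the condition
-- x₁ + x₂ < x₃ follows from x₂ ≤ x₃, and when x₁ = 0 it reduces to x₂ < x₃; so the monochromatic
-- solutions with x₁ ≤ 0 inside a color class depend only on how many negative integers, zeros and
-- positive integers the class contains (the term H a ε q, up to an added ε).  Among the positive
-- integers, the solutions number at least S(1, q) + S(q + 1, N), where q is the size of the smaller
-- positive class: by induction on the interval [g, N], its least element g lies in a class of some
-- size c and is the x₁ of at least C(c − g, 2) solutions, which is the recursion satisfied by the
-- two-block count.  Colorings whose positive part is two blocks meet both counts exactly, so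
-- every value of G is attained and every coloring is bounded below by a value of G.
module Submission where

open import Defs
open import Data.Nat as ℕ using (ℕ; _≤_; _<_; _∸_; _*_)
open import Data.Integer as ℤ using (ℤ; +_; 1ℤ; -1ℤ; 0ℤ)
open import Data.Fin as Fin using (Fin)
open import Data.Product using (_×_; Σ)
open import Relation.Binary.PropositionalEquality using (_≡_)

open import Data.Nat using (zero; suc; z≤n; s≤s; _+_; _≤?_; _<?_; _⊓_; _⊔_; _/_)
open import Data.Nat.Properties
open import Data.Nat.Combinatorics using (_C_; nC1≡n; nCk+nC[k+1]≡[n+1]C[k+1])
open import Data.Nat.DivMod using (m*n/n≡m; /-monoˡ-≤; m/n≤m)
open import Data.Nat.ListAction using (sum)
open import Data.Nat.ListAction.Properties using (sum-++)
open import Data.Nat.Tactic.RingSolver using (solve-∀)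
import Data.Integer.Properties as ℤ
import Data.Integer.Tactic.RingSolver as ℤ-Solver
open import Data.Fin using (opposite)
open import Data.Fin.Patterns using (0F; 1F)
open import Data.List using (List; []; _∷_; _++_; length; filter; map; concatMap; upTo; replicate)
open import Data.List.Properties
  using (map-++; map-cong; map-∘; foldr-preservesᵒ; foldr-preservesᵇ; length-++; length-replicate)
open import Data.List.Relation.Unary.All as All using (All; []; _∷_)
import Data.List.Relation.Unary.All.Properties as All
open import Data.List.Relation.Unary.Any as Any using (Any; here; there)
import Data.List.Relation.Unary.Any.Properties as Any
open import Data.List.Membership.Propositional using (_∈_; lose)
open import Data.List.Membership.Propositional.Properties using (∈-concatMap⁺)
open import Data.Product using (_,_; proj₂; Σ-syntax)
open import Data.Sum using (inj₁; inj₂; [_,_])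
open import Data.Empty using (⊥-elim)
open import Function using (_∘_; id)
open import Relation.Unary using (Pred; Decidable)
open import Relation.Nullary using (Dec; yes; no; ¬_)
open import Relation.Nullary.Decidable using (_×-dec_)
open import Relation.Binary.PropositionalEquality
  using (_≢_; refl; sym; trans; cong; cong₂; subst; subst₂; module ≡-Reasoning)

𝟙 : ∀ {p} {P : Set p} → Dec P → ℕ
𝟙 (yes _) = 1
𝟙 (no _)  = 0

module _ {p q} {P : Set p} {Q : Set q} where

  𝟙-cong : (p? : Dec P) (q? : Dec Q) → (P → Q) → (Q → P) → 𝟙 p? ≡ 𝟙 q?
  𝟙-cong (yes _) (yes _) _   _   = refl
  𝟙-cong (yes p) (no ¬q) p⇒q _   = ⊥-elim (¬q (p⇒q p))
  𝟙-cong (no ¬p) (yes q) _   q⇒p = ⊥-elim (¬p (q⇒p q))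
  𝟙-cong (no _)  (no _)  _   _   = refl

𝟙-yes : ∀ {p} {P : Set p} (p? : Dec P) → P → 𝟙 p? ≡ 1
𝟙-yes (yes _) _ = refl
𝟙-yes (no ¬p) p = ⊥-elim (¬p p)

𝟙-no : ∀ {p} {P : Set p} (p? : Dec P) → ¬ P → 𝟙 p? ≡ 0
𝟙-no (yes p) ¬p = ⊥-elim (¬p p)
𝟙-no (no _)  _  = refl

𝟙≤1 : ∀ {p} {P : Set p} (p? : Dec P) → 𝟙 p? ≤ 1
𝟙≤1 (yes _) = ≤-refl
𝟙≤1 (no _)  = z≤n

∑< : ℕ → (ℕ → ℕ) → ℕ
∑< zero    F = 0
∑< (suc m) F = F 0 + ∑< m (F ∘ suc)

syntax ∑< m (λ i → F) = ∑[ i < m ] F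

∑-cong-< : ∀ m {F F′ : ℕ → ℕ} → (∀ i → i < m → F i ≡ F′ i) → ∑< m F ≡ ∑< m F′
∑-cong-< zero    _  = refl
∑-cong-< (suc m) eq = cong₂ _+_ (eq 0 (s≤s z≤n)) (∑-cong-< m λ i i<m → eq (suc i) (s≤s i<m))

∑-cong : ∀ m {F F′ : ℕ → ℕ} → (∀ i → F i ≡ F′ i) → ∑< m F ≡ ∑< m F′
∑-cong m eq = ∑-cong-< m λ i _ → eq i

∑-zero : ∀ m {F : ℕ → ℕ} → (∀ i → F i ≡ 0) → ∑< m F ≡ 0
∑-zero zero    _  = refl
∑-zero (suc m) eq = cong₂ _+_ (eq 0) (∑-zero m (eq ∘ suc))

∑-one : ∀ m {F : ℕ → ℕ} → (∀ i → F i ≡ 1) → ∑< m F ≡ m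
∑-one zero    _  = refl
∑-one (suc m) eq = cong₂ _+_ (eq 0) (∑-one m (eq ∘ suc))

-- recursive n C 2 and n C 3, which unlike _C_ compute by pattern matching
choose2 : ℕ → ℕ
choose2 zero    = 0
choose2 (suc n) = n + choose2 n

choose3 : ℕ → ℕ
choose3 zero    = 0
choose3 (suc n) = choose2 n + choose3 n

choose2-mono-≤ : ∀ {m n} → m ≤ n → choose2 m ≤ choose2 n
choose2-mono-≤ z≤n       = z≤n
choose2-mono-≤ (s≤s m≤n) = +-mono-≤ m≤n (choose2-mono-≤ m≤n)

choose2-+ : ∀ m n → choose2 (m + n) ≡ choose2 m + m * n + choose2 n
choose2-+ zero    n = refl
choose2-+ (suc m) n rewrite choose2-+ m n = shuffle m n (choose2 m) (m * n) (choose2 n)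
  where
  shuffle : ∀ m n a b c → (m + n) + (a + b + c) ≡ (m + a) + (n + b) + c
  shuffle = solve-∀

choose2-superadditive : ∀ m n → choose2 m + choose2 n ≤ choose2 (m + n)
choose2-superadditive m n rewrite choose2-+ m n = +-monoˡ-≤ (choose2 n) (m≤m+n (choose2 m) (m * n))

choose2-suc-∸ : ∀ m g → choose2 (suc m ∸ g) ≡ (m ∸ g) + choose2 (m ∸ g)
choose2-suc-∸ m       zero    = refl
choose2-suc-∸ zero    (suc g) rewrite 0∸n≡0 g = refl
choose2-suc-∸ (suc m) (suc g) = choose2-suc-∸ m g

IndexColoring : Set
IndexColoring = ℕ → Fin 2

drop : ℕ → IndexColoring → IndexColoring
drop k f i = f (k + i)

colorCount : IndexColoring → Fin 2 → ℕ → ℕ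
colorCount f c m = ∑[ i < m ] 𝟙 (f i Fin.≟ c)

colorCount-yes : ∀ f {c} m → f 0 ≡ c → colorCount f c (suc m) ≡ suc (colorCount (drop 1 f) c m)
colorCount-yes f m f0≡c = cong (_+ colorCount (drop 1 f) _ m) (𝟙-yes (f 0 Fin.≟ _) f0≡c)

colorCount-no : ∀ f {c} m → f 0 ≢ c → colorCount f c (suc m) ≡ colorCount (drop 1 f) c m
colorCount-no f m f0≢c = cong (_+ colorCount (drop 1 f) _ m) (𝟙-no (f 0 Fin.≟ _) f0≢c)

colorCount-ext : ∀ {f f′} c m → (∀ i → i < m → f i ≡ f′ i) → colorCount f c m ≡ colorCount f′ c m
colorCount-ext {f} {f′} c m f≗f′ = ∑-cong-< m λ i i<m →
  𝟙-cong (f i Fin.≟ c) (f′ i Fin.≟ c) (trans (sym (f≗f′ i i<m))) (trans (f≗f′ i i<m))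

colorCount-split : ∀ f c d N →
  colorCount f c (suc d + N) ≡ colorCount f c d + 𝟙 (f d Fin.≟ c) + colorCount (drop (suc d) f) c N
colorCount-split f c zero    N = refl
colorCount-split f c (suc d) N = trans (cong (_+_ (𝟙 (f 0 Fin.≟ c))) (colorCount-split (drop 1 f) c d N))
  (reassoc (𝟙 (f 0 Fin.≟ c)) (colorCount (drop 1 f) c d) (𝟙 (f (suc d) Fin.≟ c))
           (colorCount (drop (suc (suc d)) f) c N))
  where
  reassoc : ∀ a b c d → a + (b + c + d) ≡ a + b + c + d
  reassoc = solve-∀

opposite-≢ : (c : Fin 2) → c ≢ opposite c
opposite-≢ 0F ()
opposite-≢ 1F ()

𝟙-opposite : ∀ (x c : Fin 2) → 𝟙 (x Fin.≟ opposite c) ≡ 1 ∸ 𝟙 (x Fin.≟ c)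
𝟙-opposite 0F 0F = refl
𝟙-opposite 0F 1F = refl
𝟙-opposite 1F 0F = refl
𝟙-opposite 1F 1F = refl

colorCount-opposite : ∀ f c m → colorCount f c m + colorCount f (opposite c) m ≡ m
colorCount-opposite f c zero    = refl
colorCount-opposite f c (suc m) rewrite 𝟙-opposite (f 0) c =
  trans (regroup (𝟙 (f 0 Fin.≟ c)) (1 ∸ 𝟙 (f 0 Fin.≟ c))
                 (colorCount (drop 1 f) c m) (colorCount (drop 1 f) (opposite c) m))
        (cong₂ _+_ (m+[n∸m]≡n (𝟙≤1 (f 0 Fin.≟ c))) (colorCount-opposite (drop 1 f) c m))
  where
  regroup : ∀ e ē x y → e + x + (ē + y) ≡ e + ē + (x + y)
  regroup = solve-∀

-- monoCount f u v m counts the monochromatic i ≤ j ≤ k < m with i + j + u < k + v: when f i is the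
-- color of x₀ + i for x₀ = u − v, these are the monochromatic solutions of E in [x₀, x₀ + m).
MonoSolution : IndexColoring → ℕ → ℕ → ℕ → ℕ → ℕ → Set
MonoSolution f u v i j k = i ≤ j × j ≤ k × i + j + u < k + v × f i ≡ f j × f j ≡ f k

monoSolution? : ∀ f u v i j k → Dec (MonoSolution f u v i j k)
monoSolution? f u v i j k =
  (i ≤? j) ×-dec (j ≤? k) ×-dec (i + j + u <? k + v) ×-dec (f i Fin.≟ f j) ×-dec (f j Fin.≟ f k)

monoCount : IndexColoring → ℕ → ℕ → ℕ → ℕ
monoCount f u v m = ∑[ i < m ] ∑[ j < m ] ∑[ k < m ] 𝟙 (monoSolution? f u v i j k)

PairSolution : IndexColoring → Fin 2 → ℕ → ℕ → ℕ → ℕ → Set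
PairSolution f c u v j k = j ≤ k × j + u < k + v × f j ≡ c × f k ≡ c

pairSolution? : ∀ f c u v j k → Dec (PairSolution f c u v j k)
pairSolution? f c u v j k = (j ≤? k) ×-dec (j + u <? k + v) ×-dec (f j Fin.≟ c) ×-dec (f k Fin.≟ c)

pairCount : IndexColoring → Fin 2 → ℕ → ℕ → ℕ → ℕ
pairCount f c u v m = ∑[ j < m ] ∑[ k < m ] 𝟙 (pairSolution? f c u v j k)

monoCount-suc : ∀ f u v m →
  monoCount f u v (suc m) ≡ pairCount f (f 0) u v (suc m) + monoCount (drop 1 f) (suc u) v m
monoCount-suc f u v m = cong₂ _+_ termsAt0 (∑-cong m termsAtSuc)
  where
  termsAt0 : (∑[ j < suc m ] ∑[ k < suc m ] 𝟙 (monoSolution? f u v 0 j k)) ≡ pairCount f (f 0) u v (suc m)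
  termsAt0 = ∑-cong (suc m) λ j → ∑-cong (suc m) λ k →
    𝟙-cong (monoSolution? f u v 0 j k) (pairSolution? f (f 0) u v j k)
      (λ { (_ , j≤k , <v , e₁ , e₂) → j≤k , <v , sym e₁ , trans (sym e₂) (sym e₁) })
      (λ { (j≤k , <v , e₁ , e₂) → z≤n , j≤k , <v , sym e₁ , trans e₁ (sym e₂) })
  shifted : ∀ i j k → suc i + suc j + u < suc k + v → i + j + suc u < k + v
  shifted i j k (s≤s lt) = subst (_< k + v) (+-suc-middle i j u) lt
    where
    +-suc-middle : ∀ i j u → i + suc j + u ≡ i + j + suc u
    +-suc-middle = solve-∀
  unshifted : ∀ i j k → i + j + suc u < k + v → suc i + suc j + u < suc k + v
  unshifted i j k lt = s≤s (subst (_< k + v) (+-suc-middle i j u) lt)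
    where
    +-suc-middle : ∀ i j u → i + j + suc u ≡ i + suc j + u
    +-suc-middle = solve-∀
  termsAtSuc : ∀ i → (∑[ j < suc m ] ∑[ k < suc m ] 𝟙 (monoSolution? f u v (suc i) j k))
                 ≡ ∑[ j < m ] ∑[ k < m ] 𝟙 (monoSolution? (drop 1 f) (suc u) v i j k)
  termsAtSuc i = cong₂ _+_
    (∑-zero (suc m) λ k → 𝟙-no (monoSolution? f u v (suc i) 0 k) λ { (() , _) })
    (∑-cong m λ j → cong₂ _+_
      (𝟙-no (monoSolution? f u v (suc i) (suc j) 0) λ { (_ , () , _) })
      (∑-cong m λ k → 𝟙-cong (monoSolution? f u v (suc i) (suc j) (suc k)) (monoSolution? (drop 1 f) (suc u) v i j k)
        (λ { (s≤s i≤j , s≤s j≤k , lt , e) → i≤j , j≤k , shifted i j k lt , e })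
        (λ { (i≤j , j≤k , lt , e) → s≤s i≤j , s≤s j≤k , unshifted i j k lt , e })))

firstRow : IndexColoring → Fin 2 → ℕ → ℕ → ℕ → ℕ
firstRow f c u v m = ∑[ k < m ] 𝟙 (pairSolution? f c u v 0 k)

pairCount-suc : ∀ f c u v m →
  pairCount f c u v (suc m) ≡ firstRow f c u v (suc m) + pairCount (drop 1 f) c u v m
pairCount-suc f c u v m = cong (_+_ (firstRow f c u v (suc m))) (∑-cong m λ j → cong₂ _+_
  (𝟙-no (pairSolution? f c u v (suc j) 0) λ { (() , _) })
  (∑-cong m λ k → 𝟙-cong (pairSolution? f c u v (suc j) (suc k)) (pairSolution? (drop 1 f) c u v j k)
    (λ { (s≤s j≤k , s≤s lt , e) → j≤k , lt , e })
    (λ { (j≤k , lt , e) → s≤s j≤k , s≤s lt , e })))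

firstRow-no : ∀ f c u v m → f 0 ≢ c → firstRow f c u v m ≡ 0
firstRow-no f c u v m f0≢c = ∑-zero m λ k → 𝟙-no (pairSolution? f c u v 0 k) λ { (_ , _ , e , _) → f0≢c e }

firstRow-< : ∀ f c {u v} m → u < v → f 0 ≡ c → firstRow f c u v m ≡ colorCount f c m
firstRow-< f c {u} {v} m u<v f0≡c = ∑-cong m λ k → 𝟙-cong (pairSolution? f c u v 0 k) (f k Fin.≟ c)
  (λ { (_ , _ , _ , e) → e })
  (λ e → z≤n , ≤-trans u<v (m≤n+m v k) , f0≡c , e)

aboveCount : IndexColoring → Fin 2 → ℕ → ℕ → ℕ
aboveCount f c g m = ∑[ k < m ] 𝟙 ((g <? k) ×-dec (f k Fin.≟ c))

firstRow-above : ∀ f c {u v} g m → u ≡ v + g → f 0 ≡ c →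
  firstRow f c u v m ≡ aboveCount f c g m
firstRow-above f c {v = v} g m refl f0≡c = ∑-cong m λ k →
  𝟙-cong (pairSolution? f c (v + g) v 0 k) ((g <? k) ×-dec (f k Fin.≟ c))
  (λ { (_ , lt , _ , e) → +-cancelˡ-< v g k (subst (v + g <_) (+-comm k v) lt) , e })
  (λ { (g<k , e) → z≤n , subst (v + g <_) (+-comm v k) (+-monoʳ-< v g<k) , f0≡c , e })

aboveCount-shift : ∀ f c g m → aboveCount f c (suc g) (suc m) ≡ aboveCount (drop 1 f) c g m
aboveCount-shift f c g m = ∑-cong m λ k →
  𝟙-cong ((suc g <? suc k) ×-dec (f (suc k) Fin.≟ c)) ((g <? k) ×-dec (f (suc k) Fin.≟ c))
  (λ { (s≤s g<k , e) → g<k , e }) (λ { (g<k , e) → s≤s g<k , e })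

aboveCount-zero : ∀ f c m → aboveCount f c 0 (suc m) ≡ colorCount (drop 1 f) c m
aboveCount-zero f c m = ∑-cong m λ k → 𝟙-cong ((0 <? suc k) ×-dec (f (suc k) Fin.≟ c)) (f (suc k) Fin.≟ c)
  proj₂ (λ e → s≤s z≤n , e)

colorCount-suc-∸ : ∀ f c m g → colorCount f c (suc m) ∸ suc g ≤ colorCount (drop 1 f) c m ∸ g
colorCount-suc-∸ f c m g = ∸-monoˡ-≤ (suc g) (+-monoˡ-≤ (colorCount (drop 1 f) c m) (𝟙≤1 (f 0 Fin.≟ c)))

aboveCount-≥ : ∀ f c g m → colorCount f c m ∸ suc g ≤ aboveCount f c g m
aboveCount-≥ f c g       zero    = z≤n
aboveCount-≥ f c zero    (suc m) = ≤-trans (colorCount-suc-∸ f c m 0) (≤-reflexive (sym (aboveCount-zero f c m)))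
aboveCount-≥ f c (suc g) (suc m) = begin
  colorCount f c (suc m) ∸ suc (suc g)  ≤⟨ colorCount-suc-∸ f c m (suc g) ⟩
  colorCount (drop 1 f) c m ∸ suc g     ≤⟨ aboveCount-≥ (drop 1 f) c g m ⟩
  aboveCount (drop 1 f) c g m           ≡⟨ aboveCount-shift f c g m ⟨
  aboveCount f c (suc g) (suc m)        ∎
  where open ≤-Reasoning

pairCount-< : ∀ f c {u v} m → u < v → pairCount f c u v m ≡ choose2 (suc (colorCount f c m))
pairCount-< f c         zero    u<v = refl
pairCount-< f c {u} {v} (suc m) u<v = byColorOf0 (f 0 Fin.≟ c)
  where
  open ≡-Reasoning
  f′ = drop 1 f
  byColorOf0 : Dec (f 0 ≡ c) → pairCount f c u v (suc m) ≡ choose2 (suc (colorCount f c (suc m)))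
  byColorOf0 (yes f0≡c) = begin
    pairCount f c u v (suc m)
      ≡⟨ pairCount-suc f c u v m ⟩
    firstRow f c u v (suc m) + pairCount f′ c u v m
      ≡⟨ cong₂ _+_ (firstRow-< f c (suc m) u<v f0≡c) (pairCount-< f′ c m u<v) ⟩
    colorCount f c (suc m) + choose2 (suc (colorCount f′ c m))
      ≡⟨ cong (_+ choose2 (suc (colorCount f′ c m))) (colorCount-yes f m f0≡c) ⟩
    choose2 (suc (suc (colorCount f′ c m)))
      ≡⟨ cong (choose2 ∘ suc) (colorCount-yes f m f0≡c) ⟨
    choose2 (suc (colorCount f c (suc m))) ∎
  byColorOf0 (no f0≢c) = begin
    pairCount f c u v (suc m)
      ≡⟨ pairCount-suc f c u v m ⟩
    firstRow f c u v (suc m) + pairCount f′ c u v m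
      ≡⟨ cong₂ _+_ (firstRow-no f c u v (suc m) f0≢c) (pairCount-< f′ c m u<v) ⟩
    choose2 (suc (colorCount f′ c m))
      ≡⟨ cong (choose2 ∘ suc) (colorCount-no f m f0≢c) ⟨
    choose2 (suc (colorCount f c (suc m))) ∎

pairCount-≡ : ∀ f c u m → pairCount f c u u m ≡ choose2 (colorCount f c m)
pairCount-≡ f c u zero    = refl
pairCount-≡ f c u (suc m) = byColorOf0 (f 0 Fin.≟ c)
  where
  open ≡-Reasoning
  f′ = drop 1 f
  byColorOf0 : Dec (f 0 ≡ c) → pairCount f c u u (suc m) ≡ choose2 (colorCount f c (suc m))
  byColorOf0 (yes f0≡c) = begin
    pairCount f c u u (suc m)
      ≡⟨ pairCount-suc f c u u m ⟩
    firstRow f c u u (suc m) + pairCount f′ c u u m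
      ≡⟨ cong₂ _+_ (trans (firstRow-above f c 0 (suc m) (sym (+-identityʳ u)) f0≡c) (aboveCount-zero f c m))
                   (pairCount-≡ f′ c u m) ⟩
    choose2 (suc (colorCount f′ c m))
      ≡⟨ cong choose2 (colorCount-yes f m f0≡c) ⟨
    choose2 (colorCount f c (suc m)) ∎
  byColorOf0 (no f0≢c) = begin
    pairCount f c u u (suc m)
      ≡⟨ pairCount-suc f c u u m ⟩
    firstRow f c u u (suc m) + pairCount f′ c u u m
      ≡⟨ cong₂ _+_ (firstRow-no f c u u (suc m) f0≢c) (pairCount-≡ f′ c u m) ⟩
    choose2 (colorCount f′ c m)
      ≡⟨ cong choose2 (colorCount-no f m f0≢c) ⟨
    choose2 (colorCount f c (suc m)) ∎

pairCount-≥ : ∀ f c v g m → choose2 (colorCount f c m ∸ g) ≤ pairCount f c (v + g) v m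
pairCount-≥ f c v g zero    rewrite 0∸n≡0 g = z≤n
pairCount-≥ f c v g (suc m) = byColorOf0 (f 0 Fin.≟ c)
  where
  open ≤-Reasoning
  f′ = drop 1 f
  byColorOf0 : Dec (f 0 ≡ c) → choose2 (colorCount f c (suc m) ∸ g) ≤ pairCount f c (v + g) v (suc m)
  byColorOf0 (yes f0≡c) = begin
    choose2 (colorCount f c (suc m) ∸ g)
      ≡⟨ cong (λ n → choose2 (n ∸ g)) (colorCount-yes f m f0≡c) ⟩
    choose2 (suc (colorCount f′ c m) ∸ g)
      ≡⟨ choose2-suc-∸ (colorCount f′ c m) g ⟩
    (colorCount f′ c m ∸ g) + choose2 (colorCount f′ c m ∸ g)
      ≡⟨ cong (λ n → n ∸ suc g + choose2 (colorCount f′ c m ∸ g)) (colorCount-yes f m f0≡c) ⟨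
    (colorCount f c (suc m) ∸ suc g) + choose2 (colorCount f′ c m ∸ g)
      ≤⟨ +-mono-≤ (aboveCount-≥ f c g (suc m)) (pairCount-≥ f′ c v g m) ⟩
    aboveCount f c g (suc m) + pairCount f′ c (v + g) v m
      ≡⟨ cong (_+ pairCount f′ c (v + g) v m) (firstRow-above f c g (suc m) refl f0≡c) ⟨
    firstRow f c (v + g) v (suc m) + pairCount f′ c (v + g) v m
      ≡⟨ pairCount-suc f c (v + g) v m ⟨
    pairCount f c (v + g) v (suc m) ∎
  byColorOf0 (no f0≢c) = begin
    choose2 (colorCount f c (suc m) ∸ g)
      ≡⟨ cong (λ n → choose2 (n ∸ g)) (colorCount-no f m f0≢c) ⟩
    choose2 (colorCount f′ c m ∸ g)
      ≤⟨ pairCount-≥ f′ c v g m ⟩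
    pairCount f′ c (v + g) v m
      ≡⟨ cong (_+ pairCount f′ c (v + g) v m) (firstRow-no f c (v + g) v (suc m) f0≢c) ⟨
    firstRow f c (v + g) v (suc m) + pairCount f′ c (v + g) v m
      ≡⟨ pairCount-suc f c (v + g) v m ⟨
    pairCount f c (v + g) v (suc m) ∎

pairCount-ext : ∀ {f f′} c u v m → (∀ i → i < m → f i ≡ f′ i) → pairCount f c u v m ≡ pairCount f′ c u v m
pairCount-ext {f} {f′} c u v m f≗f′ = ∑-cong-< m λ j j<m → ∑-cong-< m λ k k<m →
  𝟙-cong (pairSolution? f c u v j k) (pairSolution? f′ c u v j k)
    (λ { (j≤k , lt , e₁ , e₂) → j≤k , lt , trans (sym (f≗f′ j j<m)) e₁ , trans (sym (f≗f′ k k<m)) e₂ })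
    (λ { (j≤k , lt , e₁ , e₂) → j≤k , lt , trans (f≗f′ j j<m) e₁ , trans (f≗f′ k k<m) e₂ })

monoCount-ext : ∀ {f f′} u v m → (∀ i → i < m → f i ≡ f′ i) → monoCount f u v m ≡ monoCount f′ u v m
monoCount-ext {f} {f′} u v m f≗f′ = ∑-cong-< m λ i i<m → ∑-cong-< m λ j j<m → ∑-cong-< m λ k k<m →
  𝟙-cong (monoSolution? f u v i j k) (monoSolution? f′ u v i j k)
    (λ { (i≤j , j≤k , lt , e₁ , e₂) → i≤j , j≤k , lt , transport i<m j<m e₁ , transport j<m k<m e₂ })
    (λ { (i≤j , j≤k , lt , e₁ , e₂) → i≤j , j≤k , lt , transport⁻ i<m j<m e₁ , transport⁻ j<m k<m e₂ })
  where
  transport : ∀ {a b} → a < m → b < m → f a ≡ f b → f′ a ≡ f′ b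
  transport a<m b<m e = trans (sym (f≗f′ _ a<m)) (trans e (f≗f′ _ b<m))
  transport⁻ : ∀ {a b} → a < m → b < m → f′ a ≡ f′ b → f a ≡ f b
  transport⁻ a<m b<m e = trans (f≗f′ _ a<m) (trans e (sym (f≗f′ _ b<m)))

monoCount-const : ∀ (c c′ : Fin 2) u v m → monoCount (λ _ → c) u v m ≡ monoCount (λ _ → c′) u v m
monoCount-const c c′ u v m = ∑-cong m λ i → ∑-cong m λ j → ∑-cong m λ k →
  𝟙-cong (monoSolution? (λ _ → c) u v i j k) (monoSolution? (λ _ → c′) u v i j k)
    (λ { (i≤j , j≤k , lt , _) → i≤j , j≤k , lt , refl , refl })
    (λ { (i≤j , j≤k , lt , _) → i≤j , j≤k , lt , refl , refl })

monoCount-translate : ∀ f u v w m → monoCount f (u + w) (v + w) m ≡ monoCount f u v m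
monoCount-translate f u v w m = ∑-cong m λ i → ∑-cong m λ j → ∑-cong m λ k →
  𝟙-cong (monoSolution? f (u + w) (v + w) i j k) (monoSolution? f u v i j k)
    (λ { (i≤j , j≤k , lt , e) → i≤j , j≤k , +-cancelʳ-< w (i + j + u) (k + v) (regroup⁻ lt) , e })
    (λ { (i≤j , j≤k , lt , e) → i≤j , j≤k , regroup (+-monoˡ-< w lt) , e })
  where
  regroup : ∀ {x y} → x + u + w < y + v + w → x + (u + w) < y + (v + w)
  regroup {x} {y} = subst₂ _<_ (+-assoc x u w) (+-assoc y v w)
  regroup⁻ : ∀ {x y} → x + (u + w) < y + (v + w) → x + u + w < y + v + w
  regroup⁻ {x} {y} = subst₂ _<_ (sym (+-assoc x u w)) (sym (+-assoc y v w))

twoBlock : ℕ → IndexColoring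
twoBlock zero    _       = 1F
twoBlock (suc q) zero    = 0F
twoBlock (suc q) (suc i) = twoBlock q i

twoBlock-< : ∀ {q i} → i < q → twoBlock q i ≡ 0F
twoBlock-< {suc q} {zero}  _         = refl
twoBlock-< {suc q} {suc i} (s≤s i<q) = twoBlock-< i<q

twoBlock-≥ : ∀ {q i} → q ≤ i → twoBlock q i ≡ 1F
twoBlock-≥ {zero}  _         = refl
twoBlock-≥ {suc q} (s≤s q≤i) = twoBlock-≥ q≤i

colorCount-twoBlock-0 : ∀ q r → colorCount (twoBlock q) 0F (q + r) ≡ q
colorCount-twoBlock-0 zero    r = ∑-zero r λ i → refl
colorCount-twoBlock-0 (suc q) r = cong suc (colorCount-twoBlock-0 q r)

colorCount-twoBlock-1 : ∀ q r → colorCount (twoBlock q) 1F (q + r) ≡ r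
colorCount-twoBlock-1 zero    r = ∑-one r λ i → refl
colorCount-twoBlock-1 (suc q) r = colorCount-twoBlock-1 q r

aboveCount-twoBlock : ∀ q r g → aboveCount (twoBlock q) 0F g (q + r) ≡ q ∸ suc g
aboveCount-twoBlock zero    r g       = ∑-zero r λ k → 𝟙-no ((g <? k) ×-dec (1F Fin.≟ 0F)) λ ()
aboveCount-twoBlock (suc q) r zero    = trans (aboveCount-zero (twoBlock (suc q)) 0F (q + r)) (colorCount-twoBlock-0 q r)
aboveCount-twoBlock (suc q) r (suc g) = trans (aboveCount-shift (twoBlock (suc q)) 0F g (q + r)) (aboveCount-twoBlock q r g)

pairCount-twoBlock : ∀ q r v g → pairCount (twoBlock q) 0F (v + g) v (q + r) ≡ choose2 (q ∸ g)
pairCount-twoBlock zero    r v g rewrite 0∸n≡0 g =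
  ∑-zero r λ j → ∑-zero r λ k → 𝟙-no (pairSolution? (twoBlock 0) 0F (v + g) v j k) λ ()
pairCount-twoBlock (suc q) r v g = begin
  pairCount (twoBlock (suc q)) 0F (v + g) v (suc q + r)
    ≡⟨ pairCount-suc (twoBlock (suc q)) 0F (v + g) v (q + r) ⟩
  firstRow (twoBlock (suc q)) 0F (v + g) v (suc q + r) + pairCount (twoBlock q) 0F (v + g) v (q + r)
    ≡⟨ cong₂ _+_ (trans (firstRow-above (twoBlock (suc q)) 0F g (suc q + r) refl refl) (aboveCount-twoBlock (suc q) r g))
                 (pairCount-twoBlock q r v g) ⟩
  (q ∸ g) + choose2 (q ∸ g)
    ≡⟨ choose2-suc-∸ q g ⟨
  choose2 (suc q ∸ g) ∎
  where open ≡-Reasoning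

schurCount : ℕ → ℕ → ℕ
schurCount g m = monoCount (λ _ → 0F) g 0 m

schurCount-suc : ∀ g m → schurCount g (suc m) ≡ choose2 (suc m ∸ g) + schurCount (suc g) m
schurCount-suc g m = trans (monoCount-suc (λ _ → 0F) g 0 m) (cong (_+ schurCount (suc g) m) pairs)
  where
  pairs : pairCount (λ _ → 0F) 0F g 0 (suc m) ≡ choose2 (suc m ∸ g)
  pairs = trans (pairCount-ext 0F g 0 (suc m) λ i i<m → sym (twoBlock-< i<m))
                (subst (λ n → pairCount (twoBlock (suc m)) 0F g 0 n ≡ choose2 (suc m ∸ g))
                       (+-identityʳ (suc m)) (pairCount-twoBlock (suc m) 0 0 g))

monoCount-twoBlock : ∀ q r g → monoCount (twoBlock q) g 0 (q + r) ≡ schurCount g q + schurCount (g + q) r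
monoCount-twoBlock zero    r g = trans (monoCount-const 1F 0F g 0 r) (cong (λ x → schurCount x r) (sym (+-identityʳ g)))
monoCount-twoBlock (suc q) r g = begin
  monoCount (twoBlock (suc q)) g 0 (suc q + r)
    ≡⟨ monoCount-suc (twoBlock (suc q)) g 0 (q + r) ⟩
  pairCount (twoBlock (suc q)) 0F g 0 (suc q + r) + monoCount (twoBlock q) (suc g) 0 (q + r)
    ≡⟨ cong₂ _+_ (pairCount-twoBlock (suc q) r 0 g) (monoCount-twoBlock q r (suc g)) ⟩
  choose2 (suc q ∸ g) + (schurCount (suc g) q + schurCount (suc g + q) r)
    ≡⟨ +-assoc (choose2 (suc q ∸ g)) _ _ ⟨
  choose2 (suc q ∸ g) + schurCount (suc g) q + schurCount (suc g + q) r
    ≡⟨ cong₂ _+_ (schurCount-suc g q) (cong (λ x → schurCount x r) (+-suc g q)) ⟨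
  schurCount g (suc q) + schurCount (g + suc q) r ∎
  where open ≡-Reasoning

-- The positive part: two blocks are optimal

schurCount-mono : ∀ g m → schurCount g m ≤ schurCount g (suc m)
schurCount-mono g zero    = z≤n
schurCount-mono g (suc m) rewrite schurCount-suc g m | schurCount-suc g (suc m) =
  +-mono-≤ (choose2-mono-≤ (∸-monoˡ-≤ g (n≤1+n (suc m)))) (schurCount-mono (suc g) m)

schurCount-step : ∀ g m → schurCount g m ≤ schurCount (suc g) m + choose2 (m ∸ g)
schurCount-step g zero    = z≤n
schurCount-step g (suc m) rewrite schurCount-suc g m | +-comm (schurCount (suc g) (suc m)) (choose2 (suc m ∸ g)) =
  +-monoʳ-≤ (choose2 (suc m ∸ g)) (schurCount-mono (suc g) m)

blockBound : ℕ → ℕ → ℕ → ℕ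
blockBound g q r = schurCount g (q ⊓ r) + schurCount (g + q ⊓ r) (q ⊔ r)

blockBound-comm : ∀ g q r → blockBound g q r ≡ blockBound g r q
blockBound-comm g q r rewrite ⊓-comm q r | ⊔-comm q r = refl

blockBound-≤ : ∀ g {q r} → q ≤ r → blockBound g q r ≡ schurCount g q + schurCount (g + q) r
blockBound-≤ g q≤r rewrite m≤n⇒m⊓n≡m q≤r | m≤n⇒m⊔n≡n q≤r = refl

∸-split-≤ : ∀ r b g → r ≤ b → (r ∸ g) + (b ∸ (g + r)) ≤ b ∸ g
∸-split-≤ r b g r≤b rewrite sym (∸-+-assoc b g r) with r ≤? b ∸ g
... | yes r≤b∸g = ≤-trans (+-monoˡ-≤ (b ∸ g ∸ r) (m∸n≤m r g)) (≤-reflexive (m+[n∸m]≡n r≤b∸g))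
... | no r≰b∸g rewrite m≤n⇒m∸n≡0 (≰⇒≥ r≰b∸g) | +-identityʳ (r ∸ g) = ∸-monoˡ-≤ g r≤b

blockBound-suc-< : ∀ g {q r} → q < r → blockBound g (suc q) r ≡ blockBound (suc g) q r + choose2 (suc q ∸ g)
blockBound-suc-< g {q} {r} q<r = begin
  blockBound g (suc q) r
    ≡⟨ blockBound-≤ g q<r ⟩
  schurCount g (suc q) + schurCount (g + suc q) r
    ≡⟨ cong₂ _+_ (schurCount-suc g q) (cong (λ x → schurCount x r) (+-suc g q)) ⟩
  choose2 (suc q ∸ g) + schurCount (suc g) q + schurCount (suc g + q) r
    ≡⟨ rotate (choose2 (suc q ∸ g)) (schurCount (suc g) q) (schurCount (suc g + q) r) ⟩
  schurCount (suc g) q + schurCount (suc g + q) r + choose2 (suc q ∸ g)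
    ≡⟨ cong (_+ choose2 (suc q ∸ g)) (blockBound-≤ (suc g) (<⇒≤ q<r)) ⟨
  blockBound (suc g) q r + choose2 (suc q ∸ g) ∎
  where
  open ≡-Reasoning
  rotate : ∀ a b c → a + b + c ≡ b + c + a
  rotate = solve-∀

blockBound-suc-≥ : ∀ g {q r} → r ≤ q → blockBound g (suc q) r ≤ blockBound (suc g) q r + choose2 (suc q ∸ g)
blockBound-suc-≥ g {q} {r} r≤q = begin
  blockBound g (suc q) r
    ≡⟨ trans (blockBound-comm g (suc q) r) (blockBound-≤ g r≤sq) ⟩
  schurCount g r + schurCount (g + r) (suc q)
    ≡⟨ cong (_+_ (schurCount g r)) (schurCount-suc (g + r) q) ⟩
  schurCount g r + (choose2 (suc q ∸ (g + r)) + schurCount (suc g + r) q)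
    ≤⟨ +-monoˡ-≤ _ (schurCount-step g r) ⟩
  schurCount (suc g) r + choose2 (r ∸ g) + (choose2 (suc q ∸ (g + r)) + schurCount (suc g + r) q)
    ≡⟨ regroup (schurCount (suc g) r) (choose2 (r ∸ g)) (choose2 (suc q ∸ (g + r))) (schurCount (suc g + r) q) ⟩
  schurCount (suc g) r + schurCount (suc g + r) q + (choose2 (r ∸ g) + choose2 (suc q ∸ (g + r)))
    ≤⟨ +-monoʳ-≤ _ (≤-trans (choose2-superadditive (r ∸ g) (suc q ∸ (g + r)))
                             (choose2-mono-≤ (∸-split-≤ r (suc q) g r≤sq))) ⟩
  schurCount (suc g) r + schurCount (suc g + r) q + choose2 (suc q ∸ g)
    ≡⟨ cong (_+ choose2 (suc q ∸ g)) (trans (blockBound-comm (suc g) q r) (blockBound-≤ (suc g) r≤q)) ⟨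
  blockBound (suc g) q r + choose2 (suc q ∸ g) ∎
  where
  open ≤-Reasoning
  r≤sq : r ≤ suc q
  r≤sq = ≤-trans r≤q (n≤1+n q)
  regroup : ∀ a b c d → a + b + (c + d) ≡ a + d + (b + c)
  regroup = solve-∀

blockBound-suc-≤ : ∀ g q r → blockBound g (suc q) r ≤ blockBound (suc g) q r + choose2 (suc q ∸ g)
blockBound-suc-≤ g q r with suc q ≤? r
... | yes q<r = ≤-reflexive (blockBound-suc-< g q<r)
... | no q≮r  = blockBound-suc-≥ g (≤-pred (≰⇒> q≮r))

blockBound-colors : ∀ g (h : Fin 2 → ℕ) c → blockBound g (h 0F) (h 1F) ≡ blockBound g (h c) (h (opposite c))
blockBound-colors g h 0F = refl
blockBound-colors g h 1F = blockBound-comm g (h 0F) (h 1F)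

blockBound-≤-monoCount : ∀ m g f → blockBound g (colorCount f 0F m) (colorCount f 1F m) ≤ monoCount f g 0 m
blockBound-≤-monoCount zero    g f = z≤n
blockBound-≤-monoCount (suc m) g f = begin
  blockBound g (colorCount f 0F (suc m)) (colorCount f 1F (suc m))
    ≡⟨ blockBound-colors g (λ c → colorCount f c (suc m)) c ⟩
  blockBound g (colorCount f c (suc m)) (colorCount f (opposite c) (suc m))
    ≡⟨ cong₂ (blockBound g) (colorCount-yes f m refl) (colorCount-no f m (opposite-≢ c)) ⟩
  blockBound g (suc (colorCount f′ c m)) (colorCount f′ (opposite c) m)
    ≤⟨ blockBound-suc-≤ g (colorCount f′ c m) (colorCount f′ (opposite c) m) ⟩
  blockBound (suc g) (colorCount f′ c m) (colorCount f′ (opposite c) m) + choose2 (suc (colorCount f′ c m) ∸ g)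
    ≡⟨ cong₂ _+_ (blockBound-colors (suc g) (λ c → colorCount f′ c m) c)
                 (cong (λ n → choose2 (n ∸ g)) (colorCount-yes f m refl)) ⟨
  blockBound (suc g) (colorCount f′ 0F m) (colorCount f′ 1F m) + choose2 (colorCount f c (suc m) ∸ g)
    ≤⟨ +-mono-≤ (blockBound-≤-monoCount m (suc g) f′) (pairCount-≥ f c 0 g (suc m)) ⟩
  monoCount f′ (suc g) 0 m + pairCount f c g 0 (suc m)
    ≡⟨ +-comm (monoCount f′ (suc g) 0 m) (pairCount f c g 0 (suc m)) ⟩
  pairCount f c g 0 (suc m) + monoCount f′ (suc g) 0 m
    ≡⟨ monoCount-suc f g 0 m ⟨
  monoCount f g 0 (suc m) ∎
  where
  open ≤-Reasoning
  c = f 0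
  f′ = drop 1 f

-- The nonpositive part

-- H a ε q is the number of monochromatic solutions with x₁ ≤ 0 inside a color class made of a
-- negative integers, ε ≤ 1 copies of 0 and q positive integers, plus ε.  Over the two classes the
-- extra ε's add up to 1, the −1 in G.
H : ℕ → ℕ → ℕ → ℕ
H a ε q = choose2 (suc (a + ε)) * q + a * choose2 (suc q) + ε * choose2 q + choose3 (suc (suc (a + ε)))

H-suc : ∀ a ε q → H (suc a) ε q ≡ choose2 (suc (suc (a + ε + q))) + H a ε q
H-suc a ε q = trans (expand a ε q (choose2 (a + ε)) (choose2 q) (choose3 (a + ε)))
                    (cong (_+ H a ε q) (sym (choose2-+ (suc (suc (a + ε))) q)))
  where
  expand : ∀ a ε q c₂ c₂q c₃ →
    (suc (a + ε) + ((a + ε) + c₂)) * q + suc a * (q + c₂q) + ε * c₂q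
      + ((suc (a + ε) + (a + ε + c₂)) + ((a + ε + c₂) + (c₂ + c₃)))
    ≡ ((suc (a + ε) + (a + ε + c₂)) + suc (suc (a + ε)) * q + c₂q)
      + (((a + ε) + c₂) * q + a * (q + c₂q) + ε * c₂q + ((a + ε + c₂) + (c₂ + c₃)))
  expand = solve-∀

∑colors : (Fin 2 → ℕ) → ℕ
∑colors F = F 0F + F 1F

∑colors-opposite : ∀ F c → ∑colors F ≡ F c + F (opposite c)
∑colors-opposite F 0F = refl
∑colors-opposite F 1F = +-comm (F 0F) (F 1F)

-- f colors 1 − t, …, N with t = suc d, index i standing for i − d
classTerm : ℕ → IndexColoring → ℕ → Fin 2 → ℕ
classTerm N f d c = H (colorCount f c d) (𝟙 (f d Fin.≟ c)) (colorCount (drop (suc d) f) c N)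

∑colors-classTerm-suc : ∀ N d f → ∑colors (classTerm N f (suc d))
  ≡ choose2 (suc (suc (colorCount (drop 1 f) (f 0) (suc d + N)))) + ∑colors (classTerm N (drop 1 f) d)
∑colors-classTerm-suc N d f = begin
  ∑colors (classTerm N f (suc d))
    ≡⟨ ∑colors-opposite (classTerm N f (suc d)) c ⟩
  classTerm N f (suc d) c + classTerm N f (suc d) (opposite c)
    ≡⟨ cong₂ _+_ (trans (cong (λ a → H a e q) (colorCount-yes f d refl)) (H-suc A e q))
                 (cong (λ a → H a (𝟙 (f′ d Fin.≟ opposite c)) (colorCount (drop (suc d) f′) (opposite c) N))
                       (colorCount-no f d (opposite-≢ c))) ⟩
  choose2 (suc (suc (A + e + q))) + T c + T (opposite c)
    ≡⟨ cong (λ n → choose2 (suc (suc n)) + T c + T (opposite c)) (colorCount-split f′ c d N) ⟨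
  X + T c + T (opposite c)
    ≡⟨ +-assoc X (T c) (T (opposite c)) ⟩
  X + (T c + T (opposite c))
    ≡⟨ cong (_+_ X) (∑colors-opposite T c) ⟨
  X + ∑colors T ∎
  where
  open ≡-Reasoning
  c = f 0
  f′ = drop 1 f
  T = classTerm N f′ d
  A = colorCount f′ c d
  e = 𝟙 (f′ d Fin.≟ c)
  q = colorCount (drop (suc d) f′) c N
  X = choose2 (suc (suc (colorCount f′ c (suc d + N))))

monoCount-classTerms : ∀ N d {u v} f → v ≡ u + d →
  monoCount f u v (suc d + N) + 1 ≡ ∑colors (classTerm N f d) + monoCount (drop (suc d) f) 1 0 N
monoCount-classTerms N zero {u} f eq rewrite trans eq (+-identityʳ u) = begin
  monoCount f u u (suc N) + 1
    ≡⟨ cong (_+ 1) (monoCount-suc f u u N) ⟩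
  pairCount f c u u (suc N) + monoCount f′ (suc u) u N + 1
    ≡⟨ cong (_+ 1) (cong₂ _+_ (pairCount-≡ f c u (suc N)) (monoCount-translate f′ 1 0 u N)) ⟩
  choose2 (colorCount f c (suc N)) + P + 1
    ≡⟨ cong (λ n → choose2 n + P + 1) (colorCount-yes f N refl) ⟩
  q + choose2 q + P + 1
    ≡⟨ arrange q (choose2 q) q̄ (choose2 q̄) P ⟩
  H 0 1 q + H 0 0 q̄ + P
    ≡⟨ cong₂ (λ e ē → H 0 e q + H 0 ē q̄ + P)
             (𝟙-yes (c Fin.≟ c) refl) (𝟙-no (c Fin.≟ opposite c) (opposite-≢ c)) ⟨
  classTerm N f 0 c + classTerm N f 0 (opposite c) + P
    ≡⟨ cong (_+ P) (∑colors-opposite (classTerm N f 0) c) ⟨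
  ∑colors (classTerm N f 0) + P ∎
  where
  open ≡-Reasoning
  c = f 0
  f′ = drop 1 f
  P = monoCount f′ 1 0 N
  q = colorCount f′ c N
  q̄ = colorCount f′ (opposite c) N
  arrange : ∀ q c₂q q̄ c₂q̄ P → q + c₂q + P + 1
    ≡ (1 * q + 0 * (q + c₂q) + 1 * c₂q + 1) + (0 * q̄ + 0 * (q̄ + c₂q̄) + 0 * c₂q̄ + 0) + P
  arrange = solve-∀
monoCount-classTerms N (suc d) {u} {v} f eq = begin
  monoCount f u v (suc (suc d) + N) + 1
    ≡⟨ cong (_+ 1) (monoCount-suc f u v (suc d + N)) ⟩
  pairCount f c u v (suc (suc d + N)) + monoCount f′ (suc u) v (suc d + N) + 1
    ≡⟨ +-assoc (pairCount f c u v (suc (suc d + N))) _ 1 ⟩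
  pairCount f c u v (suc (suc d + N)) + (monoCount f′ (suc u) v (suc d + N) + 1)
    ≡⟨ cong₂ _+_ firstRowValue (monoCount-classTerms N d f′ (trans eq (+-suc u d))) ⟩
  X + (∑colors (classTerm N f′ d) + P)
    ≡⟨ +-assoc X _ P ⟨
  X + ∑colors (classTerm N f′ d) + P
    ≡⟨ cong (_+ P) (∑colors-classTerm-suc N d f) ⟨
  ∑colors (classTerm N f (suc d)) + P ∎
  where
  open ≡-Reasoning
  c = f 0
  f′ = drop 1 f
  P = monoCount (drop (suc (suc d)) f) 1 0 N
  X = choose2 (suc (suc (colorCount f′ c (suc d + N))))
  u<v : u < v
  u<v = subst (u <_) (sym eq) (m<m+n u (s≤s z≤n))
  firstRowValue : pairCount f c u v (suc (suc d + N)) ≡ X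
  firstRowValue = trans (pairCount-< f c (suc (suc d + N)) u<v) (cong (choose2 ∘ suc) (colorCount-yes f (suc d + N) refl))

monoCount-split : ∀ N d f c → monoCount f 1 (suc d) (suc d + N)
  ≡ (monoCount (drop (suc d) f) 1 0 N + classTerm N f d c + classTerm N f d (opposite c)) ∸ 1
monoCount-split N d f c = begin
  X                                  ≡⟨ m+n∸n≡m X 1 ⟨
  (X + 1) ∸ 1                        ≡⟨ cong (_∸ 1) (monoCount-classTerms N d {1} {suc d} f refl) ⟩
  (∑colors T + P) ∸ 1                ≡⟨ cong (λ n → (n + P) ∸ 1) (∑colors-opposite T c) ⟩
  (T c + T (opposite c) + P) ∸ 1     ≡⟨ cong (_∸ 1) (rotate (T c) (T (opposite c)) P) ⟩
  (P + T c + T (opposite c)) ∸ 1     ∎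
  where
  open ≡-Reasoning
  X = monoCount f 1 (suc d) (suc d + N)
  P = monoCount (drop (suc d) f) 1 0 N
  T = classTerm N f d
  rotate : ∀ x y z → x + y + z ≡ z + x + y
  rotate = solve-∀

-- From integer intervals to index intervals

length-filter≡sum : ∀ {a p} {A : Set a} {P : Pred A p} (P? : Decidable P) xs →
  length (filter P? xs) ≡ sum (map (𝟙 ∘ P?) xs)
length-filter≡sum P? []       = refl
length-filter≡sum P? (x ∷ xs) with P? x
... | yes _ = cong suc (length-filter≡sum P? xs)
... | no _  = length-filter≡sum P? xs

sum-map-concatMap : ∀ {a b} {A : Set a} {B : Set b} (F : B → ℕ) (g : A → List B) xs →
  sum (map F (concatMap g xs)) ≡ sum (map (λ x → sum (map F (g x))) xs)
sum-map-concatMap F g []       = refl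
sum-map-concatMap F g (x ∷ xs) = begin
  sum (map F (g x ++ concatMap g xs))                 ≡⟨ cong sum (map-++ F (g x) (concatMap g xs)) ⟩
  sum (map F (g x) ++ map F (concatMap g xs))         ≡⟨ sum-++ (map F (g x)) (map F (concatMap g xs)) ⟩
  sum (map F (g x)) + sum (map F (concatMap g xs))    ≡⟨ cong (λ n → sum (map F (g x)) + n) (sum-map-concatMap F g xs) ⟩
  sum (map F (g x)) + sum (map (λ x → sum (map F (g x))) xs) ∎
  where
  open ≡-Reasoning

sum-map-range : ∀ (F : ℤ → ℕ) lo m → sum (map F (range lo m)) ≡ ∑[ i < m ] F (lo ℤ.+ + i)
sum-map-range F lo zero    = refl
sum-map-range F lo (suc m) = cong₂ _+_ (cong F (sym (ℤ.+-identityʳ lo)))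
  (trans (sum-map-range F (lo ℤ.+ 1ℤ) m) (∑-cong m λ i → cong F (ℤ.+-assoc lo 1ℤ (+ i))))

sum-map-cong : ∀ {a} {A : Set a} {F F′ : A → ℕ} → (∀ x → F x ≡ F′ x) →
  ∀ xs → sum (map F xs) ≡ sum (map F′ xs)
sum-map-cong F≗F′ xs = cong sum (map-cong F≗F′ xs)

count-triples : ∀ {p} {P : Pred (ℤ × ℤ × ℤ) p} (P? : Decidable P) lo m →
  length (filter P? (triples (range lo m)))
    ≡ ∑[ i < m ] ∑[ j < m ] ∑[ k < m ] 𝟙 (P? (lo ℤ.+ + i , lo ℤ.+ + j , lo ℤ.+ + k))
count-triples P? lo m = begin
  length (filter P? (triples xs))
    ≡⟨ length-filter≡sum P? (triples xs) ⟩
  sum (map (𝟙 ∘ P?) (triples xs))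
    ≡⟨ sum-map-concatMap (𝟙 ∘ P?) _ xs ⟩
  sum (map (λ x → sum (map (𝟙 ∘ P?) (concatMap (λ y → map (λ z → x , y , z) xs) xs))) xs)
    ≡⟨ sum-map-cong (λ x → trans (sum-map-concatMap (𝟙 ∘ P?) _ xs)
                                  (sum-map-cong (λ y → cong sum (sym (map-∘ xs))) xs)) xs ⟩
  sum (map (λ x → sum (map (λ y → sum (map (λ z → 𝟙 (P? (x , y , z))) xs)) xs)) xs)
    ≡⟨ sum-map-range _ lo m ⟩
  ∑[ i < m ] sum (map (λ y → sum (map (λ z → 𝟙 (P? (lo ℤ.+ + i , y , z))) xs)) xs)
    ≡⟨ ∑-cong m (λ i → trans (sum-map-range _ lo m) (∑-cong m λ j → sum-map-range _ lo m)) ⟩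
  ∑[ i < m ] ∑[ j < m ] ∑[ k < m ] 𝟙 (P? (lo ℤ.+ + i , lo ℤ.+ + j , lo ℤ.+ + k)) ∎
  where
  open ≡-Reasoning
  xs = range lo m

+-cancelʳ-≤ℤ : ∀ c {x y} → x ℤ.+ c ℤ.≤ y ℤ.+ c → x ℤ.≤ y
+-cancelʳ-≤ℤ c {x} {y} le = subst₂ ℤ._≤_ (x+c-c≡x x c) (x+c-c≡x y c) (ℤ.+-monoˡ-≤ (ℤ.- c) le)
  where
  x+c-c≡x : ∀ x c → x ℤ.+ c ℤ.- c ≡ x
  x+c-c≡x = ℤ-Solver.solve-∀

+-cancelʳ-<ℤ : ∀ c {x y} → x ℤ.+ c ℤ.< y ℤ.+ c → x ℤ.< y
+-cancelʳ-<ℤ c {x} {y} lt = subst₂ ℤ._<_ (x+c-c≡x x c) (x+c-c≡x y c) (ℤ.+-monoˡ-< (ℤ.- c) lt)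
  where
  x+c-c≡x : ∀ x c → x ℤ.+ c ℤ.- c ≡ x
  x+c-c≡x = ℤ-Solver.solve-∀

module IndexTranslation (lo : ℤ) (u v : ℕ) (lo+v≡u : lo ℤ.+ + v ≡ + u) where

  private
    x : ℕ → ℤ
    x i = lo ℤ.+ + i

    x+v : ∀ i → x i ℤ.+ + v ≡ + (u + i)
    x+v i = trans (swap lo (+ i) (+ v)) (cong (ℤ._+ + i) lo+v≡u)
      where
      swap : ∀ a b c → a ℤ.+ b ℤ.+ c ≡ a ℤ.+ c ℤ.+ b
      swap = ℤ-Solver.solve-∀

    x+x+2v : ∀ i j → (x i ℤ.+ x j) ℤ.+ (+ v ℤ.+ + v) ≡ + (u + (i + j + u))
    x+x+2v i j = trans (regroup (x i) (x j) (+ v)) (trans (cong₂ ℤ._+_ (x+v i) (x+v j)) (cong +_ (shuffle u i j)))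
      where
      regroup : ∀ a b c → (a ℤ.+ b) ℤ.+ (c ℤ.+ c) ≡ (a ℤ.+ c) ℤ.+ (b ℤ.+ c)
      regroup = ℤ-Solver.solve-∀
      shuffle : ∀ u i j → u + i + (u + j) ≡ u + (i + j + u)
      shuffle = solve-∀

    x+2v : ∀ k → x k ℤ.+ (+ v ℤ.+ + v) ≡ + (u + (k + v))
    x+2v k = trans (sym (ℤ.+-assoc (x k) (+ v) (+ v))) (trans (cong (ℤ._+ + v) (x+v k)) (cong +_ (+-assoc u k v)))

    x≤x⇒≤ : ∀ {i j} → x i ℤ.≤ x j → i ≤ j
    x≤x⇒≤ {i} {j} le =
      +-cancelˡ-≤ u i j (ℤ.drop‿+≤+ (subst₂ ℤ._≤_ (x+v i) (x+v j) (ℤ.+-monoˡ-≤ (+ v) le)))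

    ≤⇒x≤x : ∀ {i j} → i ≤ j → x i ℤ.≤ x j
    ≤⇒x≤x {i} {j} le =
      +-cancelʳ-≤ℤ (+ v) (subst₂ ℤ._≤_ (sym (x+v i)) (sym (x+v j)) (ℤ.+≤+ (+-monoʳ-≤ u le)))

    x+x<x⇒ : ∀ {i j k} → x i ℤ.+ x j ℤ.< x k → i + j + u < k + v
    x+x<x⇒ {i} {j} {k} lt = +-cancelˡ-< u (i + j + u) (k + v)
      (ℤ.drop‿+<+ (subst₂ ℤ._<_ (x+x+2v i j) (x+2v k) (ℤ.+-monoˡ-< (+ v ℤ.+ + v) lt)))

    ⇒x+x<x : ∀ {i j k} → i + j + u < k + v → x i ℤ.+ x j ℤ.< x k
    ⇒x+x<x {i} {j} {k} lt = +-cancelʳ-<ℤ (+ v ℤ.+ + v)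
      (subst₂ ℤ._<_ (sym (x+x+2v i j)) (sym (x+2v k)) (ℤ.+<+ (+-monoʳ-< u lt)))

  s≡monoCount : ∀ Δ hi → s Δ lo hi ≡ monoCount (λ i → Δ (lo ℤ.+ + i)) u v (lenℤ (hi ℤ.- lo ℤ.+ 1ℤ))
  s≡monoCount Δ hi = trans (count-triples (MonoE? Δ) lo n) (∑-cong n λ i → ∑-cong n λ j → ∑-cong n λ k →
    𝟙-cong (MonoE? Δ (x i , x j , x k)) (monoSolution? (λ i → Δ (x i)) u v i j k)
      (λ { ((le₁ , le₂ , lt) , e) → x≤x⇒≤ le₁ , x≤x⇒≤ le₂ , x+x<x⇒ lt , e })
      (λ { (le₁ , le₂ , lt , e) → (≤⇒x≤x le₁ , ≤⇒x≤x le₂ , ⇒x+x<x lt) , e }))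
    where n = lenℤ (hi ℤ.- lo ℤ.+ 1ℤ)

  schurTriples≡monoCount : ∀ hi →
    length (filter SchurE? (triples (interval lo hi))) ≡ monoCount (λ _ → 0F) u v (lenℤ (hi ℤ.- lo ℤ.+ 1ℤ))
  schurTriples≡monoCount hi = trans (count-triples SchurE? lo n) (∑-cong n λ i → ∑-cong n λ j → ∑-cong n λ k →
    𝟙-cong (SchurE? (x i , x j , x k)) (monoSolution? (λ _ → 0F) u v i j k)
      (λ { (le₁ , le₂ , lt) → x≤x⇒≤ le₁ , x≤x⇒≤ le₂ , x+x<x⇒ lt , refl , refl })
      (λ { (le₁ , le₂ , lt , _) → ≤⇒x≤x le₁ , ≤⇒x≤x le₂ , ⇒x+x<x lt }))
    where n = lenℤ (hi ℤ.- lo ℤ.+ 1ℤ)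

  countColor0≡colorCount : ∀ Δ hi →
    countColor0 Δ lo hi ≡ colorCount (λ i → Δ (lo ℤ.+ + i)) 0F (lenℤ (hi ℤ.- lo ℤ.+ 1ℤ))
  countColor0≡colorCount Δ hi = trans (length-filter≡sum (λ y → Δ y Fin.≟ 0F) (interval lo hi))
                                     (sum-map-range (λ y → 𝟙 (Δ y Fin.≟ 0F)) lo (lenℤ (hi ℤ.- lo ℤ.+ 1ℤ)))

listColoring-index : ∀ lo cs i → listColoring lo cs (lo ℤ.+ + i) ≡ nth cs i
listColoring-index lo cs i = cong (nth cs ∘ lenℤ) (x+i-x≡i lo (+ i))
  where
  x+i-x≡i : ∀ x i → x ℤ.+ i ℤ.- x ≡ i
  x+i-x≡i = ℤ-Solver.solve-∀

s-listColoring : ∀ {lo} hi t cs → lo ℤ.+ + t ≡ 1ℤ →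
  s (listColoring lo cs) lo hi ≡ monoCount (nth cs) 1 t (lenℤ (hi ℤ.- lo ℤ.+ 1ℤ))
s-listColoring {lo} hi t cs lo+t≡1 = trans (IndexTranslation.s≡monoCount lo 1 t lo+t≡1 (listColoring lo cs) hi)
  (monoCount-ext 1 t (lenℤ (hi ℤ.- lo ℤ.+ 1ℤ)) λ i _ → listColoring-index lo cs i)

S≡schurCount : ∀ a b m → lenℤ (+ b ℤ.- + a ℤ.+ 1ℤ) ≡ m → S a b ≡ schurCount a m
S≡schurCount a b m len≡m =
  trans (IndexTranslation.schurTriples≡monoCount (+ a) a 0 (ℤ.+-identityʳ (+ a)) (+ b)) (cong (schurCount a) len≡m)

S[1,q]≡schurCount : ∀ q → S 1 q ≡ schurCount 1 q
S[1,q]≡schurCount q = S≡schurCount 1 q q (cong lenℤ (x-1+1≡x (+ q)))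
  where
  x-1+1≡x : ∀ x → x ℤ.- 1ℤ ℤ.+ 1ℤ ≡ x
  x-1+1≡x = ℤ-Solver.solve-∀

S[q+1,q+r]≡schurCount : ∀ q r → S (suc q) (q + r) ≡ schurCount (suc q) r
S[q+1,q+r]≡schurCount q r = S≡schurCount (suc q) (q + r) r (cong lenℤ (length≡ (+ q) (+ r)))
  where
  length≡ : ∀ x y → (x ℤ.+ y) ℤ.- (1ℤ ℤ.+ x) ℤ.+ 1ℤ ≡ y
  length≡ = ℤ-Solver.solve-∀

C2≡choose2 : ∀ n → n C 2 ≡ choose2 n
C2≡choose2 zero    = refl
C2≡choose2 (suc n) = trans (sym (nCk+nC[k+1]≡[n+1]C[k+1] n 1)) (cong₂ _+_ (nC1≡n n) (C2≡choose2 n))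

C3≡choose3 : ∀ n → n C 3 ≡ choose3 n
C3≡choose3 zero    = refl
C3≡choose3 (suc n) = trans (sym (nCk+nC[k+1]≡[n+1]C[k+1] n 2)) (cong₂ _+_ (C2≡choose2 n) (C3≡choose3 n))

G≡choose : ∀ t N a ε q → G t N a ε q ≡
  (S 1 q + S (suc q) N + choose2 (a + ε + 1) * q + choose2 (t ∸ a ∸ ε + 1) * (N ∸ q)
   + a * choose2 (q + 1) + (t ∸ 1 ∸ a) * choose2 (N ∸ q + 1) + ε * choose2 q + (1 ∸ ε) * choose2 (N ∸ q)
   + choose3 (a + ε + 2) + choose3 (t ∸ a ∸ ε + 2)) ∸ 1
G≡choose t N a ε q
  rewrite C2≡choose2 (a + ε + 1) | C2≡choose2 (t ∸ a ∸ ε + 1) | C2≡choose2 (q + 1) | C2≡choose2 (N ∸ q + 1)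
        | C2≡choose2 q | C2≡choose2 (N ∸ q) | C3≡choose3 (a + ε + 2) | C3≡choose3 (t ∸ a ∸ ε + 2) = refl

suc[a+b]∸a∸ε : ∀ a b {ε} → ε ≤ 1 → suc (a + b) ∸ a ∸ ε ≡ b + (1 ∸ ε)
suc[a+b]∸a∸ε a b ε≤1 rewrite sym (+-suc a b) | m+n∸m≡n a (suc b) with ε≤1
... | z≤n     = +-comm 1 b
... | s≤s z≤n = sym (+-identityʳ b)

G-split : ∀ a b ε q r → ε ≤ 1 →
  G (suc (a + b)) (q + r) a ε q ≡ (schurCount 1 q + schurCount (suc q) r + H a ε q + H b (1 ∸ ε) r) ∸ 1
G-split a b ε q r ε≤1
  rewrite G≡choose (suc (a + b)) (q + r) a ε q | S[1,q]≡schurCount q | S[q+1,q+r]≡schurCount q r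
        | suc[a+b]∸a∸ε a b ε≤1 | m+n∸m≡n a b | m+n∸m≡n q r
        | +-comm (a + ε) 1 | +-comm (b + (1 ∸ ε)) 1 | +-comm q 1 | +-comm r 1 | +-comm (a + ε) 2 | +-comm (b + (1 ∸ ε)) 2
  = cong (_∸ 1) (regroup (schurCount 1 q) (schurCount (suc q) r) a ε q b (1 ∸ ε) r
                  (choose2 (suc (a + ε))) (choose2 (suc (b + (1 ∸ ε)))) (choose2 (suc q)) (choose2 (suc r))
                  (choose2 q) (choose2 r) (choose3 (suc (suc (a + ε)))) (choose3 (suc (suc (b + (1 ∸ ε))))))
  where
  regroup : ∀ S₁ S₂ a ε q b ε̄ r x y z w u v α β →
    S₁ + S₂ + x * q + y * r + a * z + b * w + ε * u + ε̄ * v + α + β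
      ≡ S₁ + S₂ + (x * q + a * z + ε * u + α) + (y * r + b * w + ε̄ * v + β)
  regroup = solve-∀

minOf-≤ : ∀ {xs y} → Any (_≤ y) xs → minOf xs ≤ y
minOf-≤ {x ∷ xs} xs≤y = foldr-preservesᵒ (λ m n → [ m≤n⇒m⊓o≤n n , m≤n⇒o⊓m≤n m ]) x xs (Any.toSum xs≤y)

minOf-mono : ∀ {xs ys} → All (λ y → Any (_≤ y) xs) ys → All (λ x → Any (_≤ x) ys) xs → minOf xs ≤ minOf ys
minOf-mono {[]}    {[]}     _        _        = z≤n
minOf-mono {_ ∷ _} {[]}     _        (() ∷ _)
minOf-mono {_}     {y ∷ ys} (p ∷ ps) _        = foldr-preservesᵇ ⊓-glb (minOf-≤ p) (All.map minOf-≤ ps)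

minOf-cong : ∀ {xs ys} → All (λ y → Any (_≤ y) xs) ys → All (λ x → Any (_≤ x) ys) xs → minOf xs ≡ minOf ys
minOf-cong xs≤ys ys≤xs = ≤-antisym (minOf-mono xs≤ys ys≤xs) (minOf-mono ys≤xs xs≤ys)

Gvalues-row : ℕ → ℕ → ℕ → List ℕ
Gvalues-row t N ε = concatMap (λ a → map (λ q → G t N a ε q) (upTo (suc (N / 2)))) (upTo t)

Gvalues : ℕ → ℕ → List ℕ
Gvalues t N = concatMap (Gvalues-row t N) (0 ∷ 1 ∷ [])

Any-Gvalues : ∀ {p} {P : Pred ℕ p} {t N a ε q} → a < t → ε ≤ 1 → q ≤ N / 2 →
  P (G t N a ε q) → Any P (Gvalues t N)
Any-Gvalues {P = P} {t} {N} a<t ε≤1 q≤N/2 p = Any.concat⁺ (Any.map⁺ (atε ε≤1 (Any.concat⁺ (Any.map⁺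
  (Any.applyUpTo⁺ id (Any.map⁺ (Any.applyUpTo⁺ id p (s≤s q≤N/2))) a<t)))))
  where
  atε : ∀ {ε} → ε ≤ 1 → Any P (Gvalues-row t N ε) → Any (Any P ∘ Gvalues-row t N) (0 ∷ 1 ∷ [])
  atε {0} _ p = here p
  atε {1} _ p = there (here p)
  atε {suc (suc _)} (s≤s ()) _

All-Gvalues : ∀ {p} {P : Pred ℕ p} t N →
  (∀ {a ε q} → a < t → ε ≤ 1 → q ≤ N / 2 → P (G t N a ε q)) → All P (Gvalues t N)
All-Gvalues {P = P} t N all =
  All.concat⁺ (All.map⁺ {f = Gvalues-row t N} (atε (s≤s z≤n) ∷ atε (s≤s (s≤s z≤n)) ∷ []))
  where
  atε : ∀ {ε} → ε < 2 → All P (Gvalues-row t N ε)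
  atε ε<2 = All.concat⁺ (All.map⁺ (All.applyUpTo⁺₁ id t λ a<t →
    All.map⁺ (All.applyUpTo⁺₁ id (suc (N / 2)) λ q<1+N/2 → all a<t (≤-pred ε<2) (≤-pred q<1+N/2))))

minorityColor : (h : Fin 2 → ℕ) → Σ[ c ∈ Fin 2 ] h c ≤ h (opposite c)
minorityColor h with ≤-total (h 0F) (h 1F)
... | inj₁ h0≤h1 = 0F , h0≤h1
... | inj₂ h1≤h0 = 1F , h1≤h0

≤-half : ∀ {q N} → q + q ≤ N → q ≤ N / 2
≤-half {q} {N} q+q≤N = subst (_≤ N / 2) (m*n/n≡m q 2) (/-monoˡ-≤ 2 (subst (_≤ N) (q+q≡q*2 q) q+q≤N))
  where
  q+q≡q*2 : ∀ q → q + q ≡ q * 2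
  q+q≡q*2 = solve-∀

G-≤-monoCount : ∀ d N f → Any (_≤ monoCount f 1 (suc d) (suc d + N)) (Gvalues (suc d) N)
G-≤-monoCount d N f with minorityColor (λ c → colorCount (drop (suc d) f) c N)
... | c , q≤r = Any-Gvalues {t = suc d} {N} {a} {ε} {q} a<t (𝟙≤1 (f d Fin.≟ c)) q≤N/2 G≤monoCount
  where
  open ≤-Reasoning
  pos = drop (suc d) f
  Q = λ c → colorCount pos c N
  a = colorCount f c d
  b = colorCount f (opposite c) d
  ε = 𝟙 (f d Fin.≟ c)
  q = Q c
  r = Q (opposite c)
  a+b≡d : a + b ≡ d
  a+b≡d = colorCount-opposite f c d
  q+r≡N : q + r ≡ N
  q+r≡N = colorCount-opposite pos c N
  a<t : a < suc d
  a<t = s≤s (subst (a ≤_) a+b≡d (m≤m+n a b))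
  q≤N/2 : q ≤ N / 2
  q≤N/2 = ≤-half (subst (q + q ≤_) q+r≡N (+-monoʳ-≤ q q≤r))
  positivePart : schurCount 1 q + schurCount (suc q) r ≤ monoCount pos 1 0 N
  positivePart = begin
    schurCount 1 q + schurCount (suc q) r  ≡⟨ blockBound-≤ 1 q≤r ⟨
    blockBound 1 q r                       ≡⟨ blockBound-colors 1 Q c ⟨
    blockBound 1 (Q 0F) (Q 1F)             ≤⟨ blockBound-≤-monoCount N 1 pos ⟩
    monoCount pos 1 0 N                    ∎
  G≤monoCount : G (suc d) N a ε q ≤ monoCount f 1 (suc d) (suc d + N)
  G≤monoCount = begin
    G (suc d) N a ε q
      ≡⟨ cong₂ (λ d N → G (suc d) N a ε q) a+b≡d q+r≡N ⟨
    G (suc (a + b)) (q + r) a ε q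
      ≡⟨ G-split a b ε q r (𝟙≤1 (f d Fin.≟ c)) ⟩
    (schurCount 1 q + schurCount (suc q) r + H a ε q + H b (1 ∸ ε) r) ∸ 1
      ≤⟨ ∸-monoˡ-≤ 1 (+-monoˡ-≤ (H b (1 ∸ ε) r) (+-monoˡ-≤ (H a ε q) positivePart)) ⟩
    (monoCount pos 1 0 N + H a ε q + H b (1 ∸ ε) r) ∸ 1
      ≡⟨ cong (λ ε̄ → (monoCount pos 1 0 N + H a ε q + H b ε̄ r) ∸ 1) (𝟙-opposite (f d) c) ⟨
    (monoCount pos 1 0 N + classTerm N f d c + classTerm N f d (opposite c)) ∸ 1
      ≡⟨ monoCount-split N d f c ⟨
    monoCount f 1 (suc d) (suc d + N) ∎

∈-allColorLists : ∀ cs → cs ∈ allColorLists (length cs)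
∈-allColorLists []       = here refl
∈-allColorLists (c ∷ cs) =
  ∈-concatMap⁺ (λ cs → (0F ∷ cs) ∷ (1F ∷ cs) ∷ []) (lose (∈-allColorLists cs) (extend c))
  where
  extend : ∀ c → c ∷ cs ∈ (0F ∷ cs) ∷ (1F ∷ cs) ∷ []
  extend 0F = here refl
  extend 1F = there (here refl)

nth-replicate-++-< : ∀ k c ys {i} → i < k → nth (replicate k c ++ ys) i ≡ c
nth-replicate-++-< (suc k) c ys {zero}  _         = refl
nth-replicate-++-< (suc k) c ys {suc i} (s≤s i<k) = nth-replicate-++-< k c ys i<k

nth-replicate-++-+ : ∀ k c ys i → nth (replicate k c ++ ys) (k + i) ≡ nth ys i
nth-replicate-++-+ zero    c ys i = refl
nth-replicate-++-+ (suc k) c ys i = nth-replicate-++-+ k c ys i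

blocks : ℕ → ℕ → List (Fin 2) → List (Fin 2)
blocks q r ys = replicate q 0F ++ replicate r 1F ++ ys

nth-blocks-< : ∀ q r ys {i} → i < q + r → nth (blocks q r ys) i ≡ twoBlock q i
nth-blocks-< zero    r ys         i<r       = nth-replicate-++-< r 1F ys i<r
nth-blocks-< (suc q) r ys {zero}  _         = refl
nth-blocks-< (suc q) r ys {suc i} (s≤s i<n) = nth-blocks-< q r ys i<n

nth-blocks-+ : ∀ q r ys i → nth (blocks q r ys) (q + r + i) ≡ nth ys i
nth-blocks-+ zero    r ys i = nth-replicate-++-+ r 1F ys i
nth-blocks-+ (suc q) r ys i = nth-blocks-+ q r ys i

length-blocks : ∀ q r ys → length (blocks q r ys) ≡ q + r + length ys
length-blocks q r ys = begin
  length (replicate q 0F ++ replicate r 1F ++ ys)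
    ≡⟨ length-++ (replicate q 0F) ⟩
  length (replicate q 0F) + length (replicate r 1F ++ ys)
    ≡⟨ cong₂ _+_ (length-replicate q) (length-++ (replicate r 1F)) ⟩
  q + (length (replicate r 1F) + length ys)
    ≡⟨ cong (λ n → q + (n + length ys)) (length-replicate r) ⟩
  q + (r + length ys)
    ≡⟨ +-assoc q r (length ys) ⟨
  q + r + length ys ∎
  where open ≡-Reasoning

colorOfZero : ℕ → Fin 2
colorOfZero zero    = 1F
colorOfZero (suc _) = 0F

𝟙-colorOfZero : ∀ {ε} → ε ≤ 1 → 𝟙 (colorOfZero ε Fin.≟ 0F) ≡ ε
𝟙-colorOfZero z≤n       = refl
𝟙-colorOfZero (s≤s z≤n) = refl

-- the colors of 1 − t, …, −1, 0, 1, …, N for t = a + b + 1 and N = q + r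
witness : ℕ → ℕ → ℕ → ℕ → ℕ → List (Fin 2)
witness a b ε q r = blocks a b (colorOfZero ε ∷ blocks q r [])

module Witness (a b ε q r : ℕ) where

  f : IndexColoring
  f = nth (witness a b ε q r)

  length-witness : length (witness a b ε q r) ≡ suc (a + b) + (q + r)
  length-witness = begin
    length (witness a b ε q r)                     ≡⟨ length-blocks a b _ ⟩
    a + b + suc (length (blocks q r []))           ≡⟨ cong (λ n → a + b + suc n) (length-blocks q r []) ⟩
    a + b + suc (q + r + 0)                        ≡⟨ cong (λ n → a + b + suc n) (+-identityʳ (q + r)) ⟩
    a + b + suc (q + r)                            ≡⟨ +-suc (a + b) (q + r) ⟩
    suc (a + b) + (q + r)                          ∎
    where open ≡-Reasoning

  f-negative : ∀ i → i < a + b → f i ≡ twoBlock a i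
  f-negative i = nth-blocks-< a b _

  f-zero : f (a + b) ≡ colorOfZero ε
  f-zero = trans (cong f (sym (+-identityʳ (a + b)))) (nth-blocks-+ a b _ 0)

  f-positive : ∀ i → i < q + r → drop (suc (a + b)) f i ≡ twoBlock q i
  f-positive i i<N =
    trans (cong f (sym (+-suc (a + b) i))) (trans (nth-blocks-+ a b _ (suc i)) (nth-blocks-< q r [] i<N))

  negativeColor0 : colorCount f 0F (a + b) ≡ a
  negativeColor0 = trans (colorCount-ext 0F (a + b) f-negative) (colorCount-twoBlock-0 a b)

  monoCount-witness : ε ≤ 1 → monoCount f 1 (suc (a + b)) (suc (a + b) + (q + r)) ≡ G (suc (a + b)) (q + r) a ε q
  monoCount-witness ε≤1 = begin
    monoCount f 1 (suc (a + b)) (suc (a + b) + (q + r))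
      ≡⟨ monoCount-split (q + r) (a + b) f 0F ⟩
    (monoCount pos 1 0 (q + r) + classTerm (q + r) f (a + b) 0F + classTerm (q + r) f (a + b) 1F) ∸ 1
      ≡⟨ cong (_∸ 1) (cong₂ _+_ (cong₂ _+_ positivePart class0) class1) ⟩
    (schurCount 1 q + schurCount (suc q) r + H a ε q + H b (1 ∸ ε) r) ∸ 1
      ≡⟨ G-split a b ε q r ε≤1 ⟨
    G (suc (a + b)) (q + r) a ε q ∎
    where
    open ≡-Reasoning
    pos = drop (suc (a + b)) f
    εᶠ≡ε : 𝟙 (f (a + b) Fin.≟ 0F) ≡ ε
    εᶠ≡ε = trans (cong (λ x → 𝟙 (x Fin.≟ 0F)) f-zero) (𝟙-colorOfZero ε≤1)
    positivePart : monoCount pos 1 0 (q + r) ≡ schurCount 1 q + schurCount (suc q) r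
    positivePart = trans (monoCount-ext 1 0 (q + r) f-positive) (monoCount-twoBlock q r 1)
    class0 : classTerm (q + r) f (a + b) 0F ≡ H a ε q
    class0 = cong₂ (λ a (ε , q) → H a ε q) negativeColor0
      (cong₂ _,_ εᶠ≡ε (trans (colorCount-ext 0F (q + r) f-positive) (colorCount-twoBlock-0 q r)))
    class1 : classTerm (q + r) f (a + b) 1F ≡ H b (1 ∸ ε) r
    class1 = cong₂ (λ b (ε̄ , r) → H b ε̄ r)
      (trans (colorCount-ext 1F (a + b) f-negative) (colorCount-twoBlock-1 a b))
      (cong₂ _,_ (trans (𝟙-opposite (f (a + b)) 0F) (cong (1 ∸_) εᶠ≡ε))
                 (trans (colorCount-ext 1F (q + r) f-positive) (colorCount-twoBlock-1 q r)))

M≡Gmin : ∀ d N → M (ℤ.- (+ suc d)) (suc d + N) ≡ Gmin (suc d) N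
M≡Gmin d N = minOf-cong (All-Gvalues t N realised) (All.map⁺ (All.universal bounded (allColorLists n)))
  where
  t = suc d
  n = t + N
  lo = ℤ.- (+ t) ℤ.+ 1ℤ
  value : List (Fin 2) → ℕ
  value cs = s (listColoring lo cs) lo (ℤ.- (+ t) ℤ.+ + n)
  value≡monoCount : ∀ cs → value cs ≡ monoCount (nth cs) 1 t n
  value≡monoCount cs = trans (s-listColoring (ℤ.- (+ t) ℤ.+ + n) t cs (lo+t≡1 (+ t)))
                             (cong (monoCount (nth cs) 1 t ∘ lenℤ) (length≡ (+ t) (+ n)))
    where
    lo+t≡1 : ∀ t → (ℤ.- t ℤ.+ 1ℤ) ℤ.+ t ≡ 1ℤ
    lo+t≡1 = ℤ-Solver.solve-∀
    length≡ : ∀ t n → (ℤ.- t ℤ.+ n) ℤ.- (ℤ.- t ℤ.+ 1ℤ) ℤ.+ 1ℤ ≡ n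
    length≡ = ℤ-Solver.solve-∀
  bounded : ∀ cs → Any (_≤ value cs) (Gvalues t N)
  bounded cs = Any.map (λ G≤ → ≤-trans G≤ (≤-reflexive (sym (value≡monoCount cs)))) (G-≤-monoCount d N (nth cs))
  realised : ∀ {a ε q} → a < t → ε ≤ 1 → q ≤ N / 2 → Any (_≤ G t N a ε q) (map value (allColorLists n))
  realised {a} {ε} {q} (s≤s a≤d) ε≤1 q≤N/2 = Any.map⁺ (lose cs∈ (≤-reflexive (begin
    value cs
      ≡⟨ value≡monoCount cs ⟩
    monoCount (nth cs) 1 t n
      ≡⟨ cong₂ (λ d N → monoCount (nth cs) 1 (suc d) (suc d + N)) a+b≡d q+r≡N ⟨
    monoCount (nth cs) 1 (suc (a + b)) (suc (a + b) + (q + r))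
      ≡⟨ Witness.monoCount-witness a b ε q r ε≤1 ⟩
    G (suc (a + b)) (q + r) a ε q
      ≡⟨ cong₂ (λ d N → G (suc d) N a ε q) a+b≡d q+r≡N ⟩
    G t N a ε q ∎)))
    where
    open ≡-Reasoning
    b = d ∸ a
    r = N ∸ q
    a+b≡d : a + b ≡ d
    a+b≡d = m+[n∸m]≡n a≤d
    q+r≡N : q + r ≡ N
    q+r≡N = m+[n∸m]≡n (≤-trans q≤N/2 (m/n≤m N 2))
    cs = witness a b ε q r
    cs∈ : cs ∈ allColorLists n
    cs∈ = subst (λ m → cs ∈ allColorLists m)
                (trans (Witness.length-witness a b ε q r) (cong₂ (λ d N → suc d + N) a+b≡d q+r≡N))
                (∈-allColorLists cs)

Realisation : (t N n a ε q : ℕ) → Set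
Realisation t N n a ε q = Σ Coloring λ Δ →
  (s Δ (1ℤ ℤ.- + t) (+ n ℤ.- + t) ≡ G t N a ε q)
  × (countColor0 Δ (1ℤ ℤ.- + t) -1ℤ ≡ a)
  × (ε ≡ 1 → Δ 0ℤ ≡ 0F)
  × (ε ≡ 0 → Δ 0ℤ ≡ 1F)
  × ((x : ℤ) → 1ℤ ℤ.≤ x → x ℤ.≤ + q → Δ x ≡ 0F)
  × ((x : ℤ) → + q ℤ.< x → x ℤ.≤ + n ℤ.- + t → Δ x ≡ 1F)

witnessColoring : ∀ a b ε q r → ε ≤ 1 → Realisation (suc (a + b)) (q + r) (suc (a + b) + (q + r)) a ε q
witnessColoring a b ε q r ε≤1 = Δ , value , negativeCount , zeroColor , zeroColor , lowBlock , highBlock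
  where
  open Witness a b ε q r
  t = suc (a + b)
  N = q + r
  n = t + N
  lo = 1ℤ ℤ.- + t
  cs = witness a b ε q r
  Δ = listColoring lo cs
  D = + (a + b)
  lo+t≡1 : lo ℤ.+ + t ≡ 1ℤ
  lo+t≡1 = eq (+ t)
    where
    eq : ∀ t → (1ℤ ℤ.- t) ℤ.+ t ≡ 1ℤ
    eq = ℤ-Solver.solve-∀
  value : s Δ lo (+ n ℤ.- + t) ≡ G t N a ε q
  value = trans (s-listColoring (+ n ℤ.- + t) t cs lo+t≡1)
                (trans (cong (monoCount f 1 t ∘ lenℤ) (length≡ (+ n) (+ t))) (monoCount-witness ε≤1))
    where
    length≡ : ∀ n t → (n ℤ.- t) ℤ.- (1ℤ ℤ.- t) ℤ.+ 1ℤ ≡ n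
    length≡ = ℤ-Solver.solve-∀
  negativeCount : countColor0 Δ lo -1ℤ ≡ a
  negativeCount = begin
    countColor0 Δ lo -1ℤ
      ≡⟨ IndexTranslation.countColor0≡colorCount lo 1 t lo+t≡1 Δ -1ℤ ⟩
    colorCount (λ i → Δ (lo ℤ.+ + i)) 0F (lenℤ (-1ℤ ℤ.- lo ℤ.+ 1ℤ))
      ≡⟨ cong (colorCount (λ i → Δ (lo ℤ.+ + i)) 0F ∘ lenℤ) (length≡ D) ⟩
    colorCount (λ i → Δ (lo ℤ.+ + i)) 0F (a + b)
      ≡⟨ colorCount-ext 0F (a + b) (λ i _ → listColoring-index lo cs i) ⟩
    colorCount f 0F (a + b)
      ≡⟨ negativeColor0 ⟩
    a ∎
    where
    open ≡-Reasoning
    length≡ : ∀ d → -1ℤ ℤ.- (1ℤ ℤ.- (1ℤ ℤ.+ d)) ℤ.+ 1ℤ ≡ d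
    length≡ = ℤ-Solver.solve-∀
  Δ0 : Δ 0ℤ ≡ colorOfZero ε
  Δ0 = trans (cong Δ (point D)) (trans (listColoring-index lo cs (a + b)) f-zero)
    where
    point : ∀ d → 0ℤ ≡ (1ℤ ℤ.- (1ℤ ℤ.+ d)) ℤ.+ d
    point = ℤ-Solver.solve-∀
  zeroColor : ∀ {ε′} → ε ≡ ε′ → Δ 0ℤ ≡ colorOfZero ε′
  zeroColor refl = Δ0
  Δ-positive : ∀ i → i < N → Δ (+ suc i) ≡ twoBlock q i
  Δ-positive i i<N =
    trans (cong Δ (point D (+ i))) (trans (listColoring-index lo cs (suc (a + b) + i)) (f-positive i i<N))
    where
    point : ∀ d i → 1ℤ ℤ.+ i ≡ (1ℤ ℤ.- (1ℤ ℤ.+ d)) ℤ.+ ((1ℤ ℤ.+ d) ℤ.+ i)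
    point = ℤ-Solver.solve-∀
  lowBlock : (x : ℤ) → 1ℤ ℤ.≤ x → x ℤ.≤ + q → Δ x ≡ 0F
  lowBlock (+ zero)  (ℤ.+≤+ ()) _
  lowBlock (+ suc i) _ (ℤ.+≤+ i<q) = trans (Δ-positive i (≤-trans i<q (m≤m+n q r))) (twoBlock-< i<q)
  highBlock : (x : ℤ) → + q ℤ.< x → x ℤ.≤ + n ℤ.- + t → Δ x ≡ 1F
  highBlock (+ suc i) (ℤ.+<+ (s≤s q≤i)) x≤n-t =
    trans (Δ-positive i (ℤ.drop‿+≤+ (subst (+ suc i ℤ.≤_) (t+N-t≡N (+ t) (+ N)) x≤n-t))) (twoBlock-≥ q≤i)
    where
    t+N-t≡N : ∀ t N → (t ℤ.+ N) ℤ.- t ≡ N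
    t+N-t≡N = ℤ-Solver.solve-∀

realisation : ∀ d N n a ε q → suc d + N ≡ n → a ≤ d → ε ≤ 1 → q ≤ N → Realisation (suc d) N n a ε q
realisation d N n a ε q n≡ a≤d ε≤1 q≤N with m≤n⇒∃[o]m+o≡n a≤d | m≤n⇒∃[o]m+o≡n q≤N | n≡
... | b , refl | r , refl | refl = witnessColoring a b ε q r ε≤1

theorem4p5 : (t n : ℕ) → 2 ≤ t → t ℕ.+ 1 ≤ n →
    (M (ℤ.- (+ t)) n ≡ Gmin t (n ∸ t))
    × ((a ε q : ℕ) → a ≤ t ∸ 1 → ε ≤ 1 → 2 * q ≤ n ∸ t →
        Σ Coloring (λ Δ →
          (s Δ (1ℤ ℤ.- + t) (+ n ℤ.- + t) ≡ G t (n ∸ t) a ε q)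
          × (countColor0 Δ (1ℤ ℤ.- + t) -1ℤ ≡ a)
          × (ε ≡ 1 → Δ 0ℤ ≡ Fin.zero)
          × (ε ≡ 0 → Δ 0ℤ ≡ Fin.suc Fin.zero)
          × ((x : ℤ) → 1ℤ ℤ.≤ x → x ℤ.≤ + q → Δ x ≡ Fin.zero)
          × ((x : ℤ) → + q ℤ.< x → x ℤ.≤ + n ℤ.- + t → Δ x ≡ Fin.suc Fin.zero)))
theorem4p5 (suc d) n (s≤s _) t+1≤n =
  subst (λ n → M (ℤ.- (+ suc d)) n ≡ Gmin (suc d) N) t+N≡n (M≡Gmin d N) ,
  λ a ε q a≤d ε≤1 2q≤N → realisation d N n a ε q t+N≡n a≤d ε≤1 (≤-trans (m≤m+n q (q + 0)) 2q≤N)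
  where
  N = n ∸ suc d
  t+N≡n : suc d + N ≡ n
  t+N≡n = m+[n∸m]≡n (≤-trans (m≤m+n (suc d) 1) t+1≤n)
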